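{- Let $n$ be a positive integer, let $G$ be a finite abelian group with $|G|=v$, and let $a,b$ be integers and $S=a+bG\in\mathbb{Z}[G]$. Assume that $v$ and $m$ are positive integers with $a+vb=2n+1$ and $mv=1+6n^2+\frac{4n(n-1)(n-2)}{3}$, and that $$S^3=6mG-3S^2-2S+6nS$$ in $\mathbb{Z}[G]$. Then one of the following holds: (1) $v\mid 2n+1$; (2) $24n+1=c^2$ for some integer $c$, and $v$ divides at least one of $\frac{c^2+6c+29}{12}$ and $\frac{c^2-6c+29}{12}$.
   Context: In the group ring $\mathbb{Z}[G]$, $G$ denotes the element $\sum_{g\in G}g$ and an integer $k$ denotes $k$ times the identity element. -}

module Defs where

open import Level using (0ℓ)
open import Data.Nat using (ℕ; zero; suc)
open import Data.Fin using (Fin; _≟_)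
open import Data.Integer using (ℤ; +_; _+_; _*_; -_; _-_)
open import Relation.Binary.PropositionalEquality using (_≡_)
open import Relation.Nullary using (yes; no)
open import Algebra.Structures using (IsAbelianGroup)

-- A finite abelian group of order v, presented (up to isomorphism) with
-- carrier Fin v and propositional equality.
record FinAbGroup (v : ℕ) : Set where
  field
    _∙_ : Fin v → Fin v → Fin v
    ε   : Fin v
    _⁻¹ : Fin v → Fin v
    isAbelianGroup : IsAbelianGroup _≡_ _∙_ ε _⁻¹

∑ : ∀ {n} → (Fin n → ℤ) → ℤ
∑ {zero}  f = + 0
∑ {suc n} f = f Fin.zero + ∑ (λ i → f (Fin.suc i))

module GroupRing {v : ℕ} (G : FinAbGroup v) where
  open FinAbGroup G

  ZG : Set
  ZG = Fin v → ℤ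

  _≈_ : ZG → ZG → Set
  x ≈ y = ∀ g → x g ≡ y g

  infix 4 _≈_
  infixl 6 _⊕_ _⊖_
  infixl 7 _⊛_ _·_

  _⊕_ : ZG → ZG → ZG
  (x ⊕ y) g = x g + y g

  _⊖_ : ZG → ZG → ZG
  (x ⊖ y) g = x g - y g

  _·_ : ℤ → ZG → ZG
  (k · x) g = k * x g

  _⊛_ : ZG → ZG → ZG
  (x ⊛ y) g = ∑ (λ h → x h * y ((h ⁻¹) ∙ g))

  ι : ℤ → ZG
  ι k g with g ≟ ε
  ... | yes _ = k
  ... | no  _ = + 0

  𝔾 : ZG
  𝔾 _ = + 1

{-# OPTIONS --safe #-}
-- An element c + dG of ℤ[G] determines c as its coefficient at the identity minus its
-- coefficient at any g ≠ ε, and such elements multiply as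
-- (c + dG)(e + fG) = ce + (cf + de + v·df)G. Applied to S = a + bG, this reads the cubic
-- equation as a³ = -3a² - 2a + 6na. Hence either a = 0 and v ∣ vb = 2n + 1, or
-- a² + 3a + 2 = 6n, and then c = 2a + 3 has c² = 24n + 1 and c² - 6c + 29 = 4a² + 20 = 12vb.
module Submission where

open import Defs
open import Data.Nat as ℕ using (ℕ; zero; suc; _≥_)
import Data.Nat.DivMod as ℕ
open import Data.Nat.Divisibility using (1∣_)
open import Data.Integer using (ℤ; +_; -[1+_]; 0ℤ; 1ℤ; _+_; _*_; _-_; -_; _/ℕ_)
open import Data.Integer.Properties
  using ( +-*-semiring; +-identityˡ; +-identityʳ; *-identityˡ; *-identityʳ; *-zeroʳ; suc-*; pos-*
        ; i*j≡0⇒i≡0∨j≡0; i-j≡0⇒i≡j; i≡j⇒i-j≡0)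
open import Data.Integer.Divisibility using (_∣_)
open import Data.Integer.Divisibility.Signed using (∣⇒∣ᵤ; ∣-refl; ∣m⇒∣m*n)
open import Data.Integer.DivMod using (_/_; div-pos-is-/ℕ)
open import Data.Integer.Tactic.RingSolver using (solve-∀)
open import Data.Fin using (Fin; _≟_; punchIn)
open import Data.Fin.Properties using (punchInᵢ≢i)
open import Algebra.Properties.Semiring.Sum +-*-semiring
  using (sum; sum-cong-≗; sum-remove; sum-replicate-zero; ∑-distrib-+)
open import Algebra.Bundles using (AbelianGroup)
import Algebra.Properties.AbelianGroup as AbelianGroupProperties
open import Data.Product using (Σ; _×_; _,_)
open import Data.Sum using (_⊎_; inj₁; inj₂; [_,_]′)
open import Function using (_∘_)
open import Relation.Nullary using (yes; no; contradiction)
open import Relation.Binary.PropositionalEquality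

∑≡sum : ∀ {n} (f : Fin n → ℤ) → ∑ f ≡ sum f
∑≡sum {zero}  f = refl
∑≡sum {suc n} f = cong (_+_ (f Fin.zero)) (∑≡sum (f ∘ Fin.suc))

sum-const : ∀ n (k : ℤ) → sum {n} (λ _ → k) ≡ + n * k
sum-const zero    k = refl
sum-const (suc n) k = trans (cong (_+_ k) (sum-const n k)) (sym (suc-* (+ n) k))

sum-pointMass : ∀ {n} (f : Fin n → ℤ) p → (∀ i → i ≢ p → f i ≡ 0ℤ) → sum f ≡ f p
sum-pointMass {suc n} f p vanish = begin
  sum f                                ≡⟨ sum-remove f ⟩
  f p + sum (f ∘ punchIn p)            ≡⟨ cong (_+_ (f p)) (sum-cong-≗ (λ i → vanish _ (punchInᵢ≢i p i))) ⟩
  f p + sum {n} (λ _ → 0ℤ)             ≡⟨ cong (_+_ (f p)) (sum-replicate-zero n) ⟩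
  f p + 0ℤ                             ≡⟨ +-identityʳ (f p) ⟩
  f p                                  ∎
  where open ≡-Reasoning

i*n/n≡i : ∀ i n .{{_ : ℕ.NonZero n}} → (i * + n) / + n ≡ i
i*n/n≡i i n = trans (div-pos-is-/ℕ (i * + n) n) (i*n/ℕn≡i i n)
  where
  i*n/ℕn≡i : ∀ i n .{{_ : ℕ.NonZero n}} → (i * + n) /ℕ n ≡ i
  i*n/ℕn≡i (+ k)    n       = trans (cong (_/ℕ n) (sym (pos-* k n))) (cong +_ (ℕ.m*n/n≡m k n))
  i*n/ℕn≡i -[1+ k ] (suc n) with suc k ℕ.* suc n ℕ.% suc n in eq
  ... | zero  = cong (λ q → - (+ q)) (ℕ.m*n/n≡m (suc k) (suc n))
  ... | suc r with () ← trans (sym eq) (ℕ.m*n%n≡0 (suc k) (suc n))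

module AffineElements {v : ℕ} (G : FinAbGroup v) where
  open FinAbGroup G
  open GroupRing G

  abelianGroup : AbelianGroup _ _
  abelianGroup = record { isAbelianGroup = isAbelianGroup }

  open AbelianGroupProperties abelianGroup
    using (ε⁻¹≈ε; inverseˡ-unique; ⁻¹-injective)
  open AbelianGroup abelianGroup
    using (identityˡ; inverseˡ)

  ⁻¹∙≡ε⇒≡ : ∀ h g → (h ⁻¹) ∙ g ≡ ε → h ≡ g
  ⁻¹∙≡ε⇒≡ h g eq = ⁻¹-injective (inverseˡ-unique (h ⁻¹) g eq)

  δ : ZG
  δ = ι 1ℤ

  δ-ε : δ ε ≡ 1ℤ
  δ-ε with ε ≟ ε
  ... | yes _   = refl
  ... | no ε≢ε = contradiction refl ε≢ε

  δ-≢ε : ∀ {g} → g ≢ ε → δ g ≡ 0ℤ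
  δ-≢ε {g} g≢ε with g ≟ ε
  ... | yes g≡ε = contradiction g≡ε g≢ε
  ... | no _    = refl

  ι≗*δ : ∀ c g → ι c g ≡ c * δ g
  ι≗*δ c g with g ≟ ε
  ... | yes _ = sym (*-identityʳ c)
  ... | no _  = sym (*-zeroʳ c)

  sum-δ* : ∀ (x : ZG) → sum (λ h → δ h * x h) ≡ x ε
  sum-δ* x = trans (sum-pointMass _ ε (λ h h≢ε → cong (_* x h) (δ-≢ε h≢ε)))
                   (trans (cong (_* x ε) δ-ε) (*-identityˡ (x ε)))

  sum-δ[⁻¹∙]* : ∀ g (x : ZG) → sum (λ h → δ ((h ⁻¹) ∙ g) * x h) ≡ x g
  sum-δ[⁻¹∙]* g x = trans (sum-pointMass _ g (λ h h≢g → cong (_* x h) (δ-≢ε (h≢g ∘ ⁻¹∙≡ε⇒≡ h g))))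
                          (trans (cong (_* x g) (trans (cong δ (inverseˡ g)) δ-ε)) (*-identityˡ (x g)))

  affine : ℤ → ℤ → ZG
  affine c d = ι c ⊕ d · 𝔾

  affine≗ : ∀ c d g → affine c d g ≡ c * δ g + d
  affine≗ c d g = cong₂ _+_ (ι≗*δ c g) (*-identityʳ d)

  ⊛-congˡ : ∀ {x y} (z : ZG) → x ≈ y → x ⊛ z ≈ y ⊛ z
  ⊛-congˡ {x} {y} z x≈y g = begin
    ∑ (λ h → x h * z ((h ⁻¹) ∙ g))    ≡⟨ ∑≡sum (λ h → x h * z ((h ⁻¹) ∙ g)) ⟩
    sum (λ h → x h * z ((h ⁻¹) ∙ g))  ≡⟨ sum-cong-≗ (λ h → cong (_* z ((h ⁻¹) ∙ g)) (x≈y h)) ⟩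
    sum (λ h → y h * z ((h ⁻¹) ∙ g))  ≡⟨ ∑≡sum (λ h → y h * z ((h ⁻¹) ∙ g)) ⟨
    ∑ (λ h → y h * z ((h ⁻¹) ∙ g))    ∎
    where open ≡-Reasoning

  ⊛-affine : ∀ c d e f → affine c d ⊛ affine e f ≈ affine (c * e) (c * f + d * e + + v * d * f)
  ⊛-affine c d e f g = begin
    ∑ (λ h → affine c d h * affine e f ((h ⁻¹) ∙ g))
      ≡⟨ ∑≡sum (λ h → affine c d h * affine e f ((h ⁻¹) ∙ g)) ⟩
    sum (λ h → affine c d h * affine e f ((h ⁻¹) ∙ g))
      ≡⟨ sum-cong-≗ (λ h → product≗ h) ⟩
    sum (λ h → δ h * P h + δ ((h ⁻¹) ∙ g) * (d * e) + d * f)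
      ≡⟨ ∑-distrib-+ (λ h → δ h * P h + δ ((h ⁻¹) ∙ g) * (d * e)) (λ _ → d * f) ⟩
    sum (λ h → δ h * P h + δ ((h ⁻¹) ∙ g) * (d * e)) + sum {v} (λ _ → d * f)
      ≡⟨ cong₂ _+_ (∑-distrib-+ (λ h → δ h * P h) (λ h → δ ((h ⁻¹) ∙ g) * (d * e))) (sum-const v (d * f)) ⟩
    sum (λ h → δ h * P h) + sum (λ h → δ ((h ⁻¹) ∙ g) * (d * e)) + + v * (d * f)
      ≡⟨ cong (λ s → s + + v * (d * f)) (cong₂ _+_ (sum-δ* P) (sum-δ[⁻¹∙]* g (λ _ → d * e))) ⟩
    P ε + d * e + + v * (d * f)
      ≡⟨ cong (λ t → c * (e * δ t + f) + d * e + + v * (d * f)) (trans (cong (_∙ g) ε⁻¹≈ε) (identityˡ g)) ⟩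
    c * (e * δ g + f) + d * e + + v * (d * f)
      ≡⟨ collect c d e f (+ v) (δ g) ⟩
    c * e * δ g + (c * f + d * e + + v * d * f)
      ≡⟨ affine≗ (c * e) _ g ⟨
    affine (c * e) (c * f + d * e + + v * d * f) g ∎
    where
    open ≡-Reasoning
    P : ZG
    P h = c * (e * δ ((h ⁻¹) ∙ g) + f)
    expand : ∀ c d e f x y → (c * x + d) * (e * y + f) ≡ x * (c * (e * y + f)) + y * (d * e) + d * f
    expand = solve-∀
    collect : ∀ c d e f v x → c * (e * x + f) + d * e + v * (d * f) ≡ c * e * x + (c * f + d * e + v * d * f)
    collect = solve-∀
    product≗ : ∀ h → affine c d h * affine e f ((h ⁻¹) ∙ g) ≡ δ h * P h + δ ((h ⁻¹) ∙ g) * (d * e) + d * f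
    product≗ h = trans (cong₂ _*_ (affine≗ c d h) (affine≗ e f _)) (expand c d e f (δ h) (δ ((h ⁻¹) ∙ g)))

  excess : Fin v → ZG → ℤ
  excess g x = x ε - x g

  excess-cong : ∀ g {x y} → x ≈ y → excess g x ≡ excess g y
  excess-cong g x≈y = cong₂ _-_ (x≈y ε) (x≈y g)

  excess-affine : ∀ c d {g} → g ≢ ε → excess g (affine c d) ≡ c
  excess-affine c d {g} g≢ε = begin
    affine c d ε - affine c d g    ≡⟨ cong₂ _-_ (affine≗ c d ε) (affine≗ c d g) ⟩
    c * δ ε + d - (c * δ g + d)    ≡⟨ cong₂ (λ x y → c * x + d - (c * y + d)) δ-ε (δ-≢ε g≢ε) ⟩
    c * 1ℤ + d - (c * 0ℤ + d)      ≡⟨ cancel c d ⟩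
    c                              ∎
    where
    open ≡-Reasoning
    cancel : ∀ c d → c * 1ℤ + d - (c * 0ℤ + d) ≡ c
    cancel = solve-∀

  cubic-relation : ∀ {g} → g ≢ ε → (n m : ℕ) (a b : ℤ) →
    (let S = affine a b
     in (S ⊛ S) ⊛ S ≈ ((((+ 6 * + m) · 𝔾 ⊖ + 3 · (S ⊛ S)) ⊖ + 2 · S) ⊕ (+ 6 * + n) · S)) →
    a * (a * a + + 3 * a + + 2 - + 6 * + n) ≡ 0ℤ
  cubic-relation {g} g≢ε n m a b S³≈R = begin
    a * (a * a + + 3 * a + + 2 - + 6 * + n)  ≡⟨ factor a (+ n) ⟩
    defect (a * a * a) (a * a) a             ≡⟨ cong₂ (λ x³ x² → defect x³ x² a) (Δ-affine b₃ S³≈) (Δ-affine b₂ S²≈) ⟨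
    defect (Δ (S ⊛ S ⊛ S)) (Δ (S ⊛ S)) a     ≡⟨ cong (defect (Δ (S ⊛ S ⊛ S)) (Δ (S ⊛ S))) (Δ-affine b (λ _ → refl)) ⟨
    defect (Δ (S ⊛ S ⊛ S)) (Δ (S ⊛ S)) (Δ S) ≡⟨ Δ-linear (+ 6 * + m) (+ 6 * + n) ((S ⊛ S ⊛ S) ε) ((S ⊛ S ⊛ S) g)
                                                         ((S ⊛ S) ε) ((S ⊛ S) g) (S ε) (S g) ⟨
    Δ (S ⊛ S ⊛ S) - Δ R                      ≡⟨ i≡j⇒i-j≡0 (excess-cong g S³≈R) ⟩
    0ℤ                                       ∎
    where
    open ≡-Reasoning
    S R : ZG
    S = affine a b
    R = (((+ 6 * + m) · 𝔾 ⊖ + 3 · (S ⊛ S)) ⊖ + 2 · S) ⊕ (+ 6 * + n) · S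
    Δ : ZG → ℤ
    Δ = excess g
    Δ-affine : ∀ {x c} d → x ≈ affine c d → Δ x ≡ c
    Δ-affine {c = c} d x≈ = trans (excess-cong g x≈) (excess-affine c d g≢ε)
    b₂ b₃ : ℤ
    b₂ = a * b + b * a + + v * b * b
    b₃ = a * a * b + b₂ * a + + v * b₂ * b
    S²≈ : S ⊛ S ≈ affine (a * a) b₂
    S²≈ = ⊛-affine a b a b
    S³≈ : S ⊛ S ⊛ S ≈ affine (a * a * a) b₃
    S³≈ h = trans (⊛-congˡ S S²≈ h) (⊛-affine (a * a) b₂ a b h)
    defect : ℤ → ℤ → ℤ → ℤ
    defect x³ x² x = x³ - (+ 6 * + n * x - + 3 * x² - + 2 * x)
    factor : ∀ a n → a * (a * a + + 3 * a + + 2 - + 6 * n) ≡ a * a * a - (+ 6 * n * a - + 3 * (a * a) - + 2 * a)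
    factor = solve-∀
    Δ-linear : ∀ M N y³ z³ y² z² y z →
      (y³ - z³) - ((M * 1ℤ - + 3 * y² - + 2 * y + N * y) - (M * 1ℤ - + 3 * z² - + 2 * z + N * z))
        ≡ (y³ - z³) - (N * (y - z) - + 3 * (y² - z²) - + 2 * (y - z))
    Δ-linear = solve-∀

n∣n*i : ∀ n i → + n ∣ + n * i
n∣n*i n i = ∣⇒∣ᵤ (∣m⇒∣m*n {+ n} i ∣-refl)

a≡0⇒v∣2n+1 : ∀ v n {a} b → a ≡ 0ℤ → a + + v * b ≡ + 2 * + n + + 1 → + v ∣ + 2 * + n + + 1
a≡0⇒v∣2n+1 v n b refl a+vb≡2n+1 = subst (+ v ∣_) (trans (sym (+-identityˡ (+ v * b))) a+vb≡2n+1) (n∣n*i v b)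

a²+3a+2≡6n⇒square-case : ∀ v n a b → a + + v * b ≡ + 2 * + n + + 1 → a * a + + 3 * a + + 2 - + 6 * + n ≡ 0ℤ →
  Σ ℤ (λ c → (+ 24 * + n + + 1 ≡ c * c)
        × ((+ v ∣ ((c * c + + 6 * c + + 29) / + 12))
           ⊎ (+ v ∣ ((c * c - + 6 * c + + 29) / + 12))))
a²+3a+2≡6n⇒square-case v n a b a+vb≡2n+1 quadratic≡0 = c , sym c²≡24n+1 , inj₂ v∣[c²-6c+29]/12
  where
  c = + 2 * a + + 3
  c²-identity : ∀ a N → (+ 2 * a + + 3) * (+ 2 * a + + 3) - (+ 24 * N + + 1) ≡ + 4 * (a * a + + 3 * a + + 2 - + 6 * N)
  c²-identity = solve-∀
  c²-6c+29-identity : ∀ a N vb → let c = + 2 * a + + 3 in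
    (c * c - + 6 * c + + 29) - vb * + 12 ≡ + 4 * (a * a + + 3 * a + + 2 - + 6 * N) - + 12 * ((a + vb) - (+ 2 * N + + 1))
  c²-6c+29-identity = solve-∀
  c²≡24n+1 : c * c ≡ + 24 * + n + + 1
  c²≡24n+1 = i-j≡0⇒i≡j _ _ (trans (c²-identity a (+ n)) (cong (+ 4 *_) quadratic≡0))
  c²-6c+29≡vb*12 : c * c - + 6 * c + + 29 ≡ + v * b * + 12
  c²-6c+29≡vb*12 = i-j≡0⇒i≡j _ _ (trans (c²-6c+29-identity a (+ n) (+ v * b))
                     (cong₂ (λ x y → + 4 * x - + 12 * y) quadratic≡0 (i≡j⇒i-j≡0 a+vb≡2n+1)))
  v∣[c²-6c+29]/12 : + v ∣ ((c * c - + 6 * c + + 29) / + 12)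
  v∣[c²-6c+29]/12 = subst (λ x → + v ∣ (x / + 12)) (sym c²-6c+29≡vb*12)
                      (subst (+ v ∣_) (sym (i*n/n≡i (+ v * b) 12)) (n∣n*i v b))

lemma6 : (n : ℕ) → n ≥ 1 → (v : ℕ) → (G : FinAbGroup v) → (a b : ℤ) → (m : ℕ) →
    v ≥ 1 → m ≥ 1 →
    a + + v * b ≡ + 2 * + n + + 1 →
    + 3 * (+ m * + v) ≡ + 3 + + 18 * (+ n * + n) + + 4 * (+ n * (+ n - + 1) * (+ n - + 2)) →
    (let open GroupRing G
         S = ι a ⊕ b · 𝔾
     in (S ⊛ S) ⊛ S ≈ ((((+ 6 * + m) · 𝔾 ⊖ + 3 · (S ⊛ S)) ⊖ + 2 · S) ⊕ (+ 6 * + n) · S)) →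
    (+ v ∣ (+ 2 * + n + + 1))
    ⊎ Σ ℤ (λ c → (+ 24 * + n + + 1 ≡ c * c)
        × ((+ v ∣ ((c * c + + 6 * c + + 29) / + 12))
           ⊎ (+ v ∣ ((c * c - + 6 * c + + 29) / + 12))))
lemma6 n _ (suc zero) G a b m _ _ _ _ _ = inj₁ (1∣ _)
lemma6 n _ v@(suc (suc _)) G a b m _ _ a+vb≡2n+1 _ S³≈R =
  [ (λ a≡0 → inj₁ (a≡0⇒v∣2n+1 v n b a≡0 a+vb≡2n+1))
  , (λ quadratic≡0 → inj₂ (a²+3a+2≡6n⇒square-case v n a b a+vb≡2n+1 quadratic≡0))
  ]′ (i*j≡0⇒i≡0∨j≡0 a (cubic-relation (punchInᵢ≢i (FinAbGroup.ε G) Fin.zero) n m a b S³≈R))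
  where open AffineElements G
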